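{- There exists a family of $n\times n$ matrices $M$ (for infinitely many $n$) such that $\delta_{2D}(M)=O(1)$ and $\gamma_{2D}(M)=\Omega(\sqrt{n})$.
   Context: For $M\in\Sigma^{n\times n}$, $M[i:i+a-1][j:j+b-1]$ denotes the $a\times b$ submatrix with rows $i,\dots,i+a-1$ and columns $j,\dots,j+b-1$. An occurrence of an $\ell\times\ell$ matrix $I$ in $M$ is a position $(i',j')$ with $M[i':i'+\ell-1][j':j'+\ell-1]=I$; it crosses position $p=(a,b)$ if $i'\le a\le i'+\ell-1$ and $j'\le b\le j'+\ell-1$. A two-dimensional attractor for $M$ is a set $\Gamma_{2D}\subseteq\{1,\dots,n\}\times\{1,\dots,n\}$ such that every square submatrix of $M$ has an occurrence crossing some position of $\Gamma_{2D}$; $\gamma_{2D}(M)$ is the minimum cardinality of such an attractor. For $k\in[1,n]$ let $d_{k\times k}(M)$ be the number of distinct $k\times k$ submatrices of $M$, and $\delta_{2D}(M)=\max\{d_{k\times k}(M)/k^2 : k\in[1,n]\}$. -}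

module Defs where

open import Data.Nat using (ℕ; zero; suc; _+_; _*_; _∸_; _≤_; _<_)
open import Data.Nat.Properties using (+-monoʳ-<; ≤-trans; +-monoˡ-≤; m∸n+n≡m; ≤-reflexive)
open import Data.Fin using (Fin; toℕ; fromℕ<)
import Data.Fin as Fin
open import Data.Fin.Properties using (toℕ<n)
open import Data.Nat.Properties using (<-≤-trans; +-comm)
open import Data.Vec using (Vec; tabulate)
open import Data.Vec.Properties using (≡-dec)
open import Data.List using (List; length; map; cartesianProduct; deduplicate; allFin)
open import Data.List.Relation.Unary.Any using (Any)
open import Data.Product using (Σ; _×_; _,_; ∃)
open import Relation.Binary.PropositionalEquality using (_≡_)

Mat : Set → ℕ → Set
Mat A n = Fin n → Fin n → A

-- Admissible top-left coordinates of a k×k window: 0 .. n-k, i.e. Fin (suc (n ∸ k)).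
Pos : ℕ → ℕ → Set
Pos n k = Fin (suc (n ∸ k))

bound : ∀ {n k} → k ≤ n → (i : Pos n k) → (r : Fin k) → toℕ i + toℕ r < n
bound {n} {k} k≤n i r =
  <-≤-trans (+-monoʳ-< (toℕ i) (toℕ<n r))
    (≤-trans (+-monoˡ-≤ k (Data.Nat.Properties.≤-pred (toℕ<n i)))
      (≤-reflexive (m∸n+n≡m k≤n)))

window : ∀ {A n} → Mat A n → (k : ℕ) → k ≤ n → Pos n k → Pos n k → Vec (Vec A k) k
window M k k≤n i j =
  tabulate λ r → tabulate λ s → M (fromℕ< (bound k≤n i r)) (fromℕ< (bound k≤n j s))

dsub : ∀ {σ n} → Mat (Fin σ) n → (k : ℕ) → k ≤ n → ℕ
dsub {σ} {n} M k k≤n =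
  length (deduplicate (≡-dec (≡-dec Fin._≟_))
    (map (λ p → window M k k≤n (Data.Product.proj₁ p) (Data.Product.proj₂ p))
         (cartesianProduct (allFin (suc (n ∸ k))) (allFin (suc (n ∸ k))))))

Crosses : ∀ {n k} → Pos n k → Pos n k → Fin n × Fin n → Set
Crosses {n} {k} i' j' (a , b) =
  (toℕ i' ≤ toℕ a × toℕ a < toℕ i' + k) × (toℕ j' ≤ toℕ b × toℕ b < toℕ j' + k)

IsAttractor2D : ∀ {A n} → Mat A n → List (Fin n × Fin n) → Set
IsAttractor2D {A} {n} M Γ =
  ∀ (k : ℕ) → 1 ≤ k → (k≤n : k ≤ n) → (i j : Pos n k) →
    Σ (Pos n k) λ i' → Σ (Pos n k) λ j' →
      (window M k k≤n i' j' ≡ window M k k≤n i j) × Any (Crosses {n} {k} i' j') Γ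

-- The matrix has 1s exactly at the entries (p², 0) of column 0. A k × k window either misses
-- column 0 (all zeros), starts above row k² (fewer than k² positions), or lies below row k²,
-- where consecutive squares are more than k apart, so it shows at most one 1 (k + 1 shapes):
-- hence d_k ≤ 3k². Conversely the window of height 2t + 2 at (t², 0) shows exactly the squares
-- t² and (t + 1)², and since the gap 2a + 1 after a² determines a, it occurs only at (t², 0).
-- An attractor thus meets every row band [t², (t + 1)²]; for the even t < 2N + 2 these bands
-- are disjoint, so n = (2N + 2)² gives |Γ| ≥ N + 1 and n ≤ 4 |Γ|².

module Submission where

open import Defs

open import Data.Bool using (Bool; true; false)
open import Data.Empty using (⊥-elim)
open import Data.Fin using (Fin; toℕ; fromℕ<)
import Data.Fin as Fin
open import Data.Fin.Properties using (toℕ<n; toℕ-fromℕ<; toℕ-injective; injective⇒≤; 0≢1+n)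
open import Data.List using (List; _∷_; length; map; _++_; upTo; cartesianProduct; allFin)
import Data.List as List
open import Data.List.Properties using (length-map; length-++; length-upTo)
open import Data.List.Membership.Propositional using (_∈_)
open import Data.List.Membership.Propositional.Properties
  using (∈-lookup; ∈-map⁺; ∈-map⁻; ∈-++⁺ˡ; ∈-++⁺ʳ; ∈-upTo⁺; ∈-deduplicate⁻)
open import Data.List.Relation.Unary.Any using (Any; here; there; index)
import Data.List.Relation.Unary.Any as Any
open import Data.List.Relation.Unary.Any.Properties using (lookup-index)
import Data.List.Relation.Unary.All as All
open import Data.List.Relation.Unary.AllPairs using (_∷_)
open import Data.List.Relation.Unary.Unique.Propositional using (Unique)
import Data.List.Relation.Unary.Unique.DecPropositional.Properties as Unique
open import Data.Nat using (ℕ; zero; suc; _+_; _*_; _∸_; _≤_; _<_; z≤n; s≤s; z<s; _≟_; _<?_)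
open import Data.Nat.Properties hiding (0≢1+n)
open import Data.Nat.Tactic.RingSolver using (solve-∀)
open import Data.Product using (Σ; ∃; _×_; _,_)
open import Data.Vec using (Vec; tabulate; lookup)
open import Data.Vec.Properties using (tabulate-cong; lookup∘tabulate; ≡-dec)
open import Function.Bundles using (_⇔_; mk⇔)
open import Level using (0ℓ)
open import Relation.Binary.Definitions using (DecidableEquality; tri<; tri≈; tri>)
open import Relation.Binary.PropositionalEquality
open import Relation.Nullary using (yes; no; ¬_; does)
open import Relation.Nullary.Decidable using (map′; dec-true; dec-false; does-⇔)
open import Relation.Unary using (Pred; Decidable)

module _ {A : Set} where

  Unique⇒lookup-injective : ∀ {xs : List A} → Unique xs → ∀ i j → List.lookup xs i ≡ List.lookup xs j → i ≡ j
  Unique⇒lookup-injective (_ ∷ _) Fin.zero Fin.zero _ = refl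
  Unique⇒lookup-injective (x∉ ∷ _) Fin.zero (Fin.suc j) e = ⊥-elim (All.lookup x∉ (∈-lookup j) e)
  Unique⇒lookup-injective (x∉ ∷ _) (Fin.suc i) Fin.zero e = ⊥-elim (All.lookup x∉ (∈-lookup i) (sym e))
  Unique⇒lookup-injective (_ ∷ u) (Fin.suc i) (Fin.suc j) e = cong Fin.suc (Unique⇒lookup-injective u i j e)

  Unique⇒length≤ : ∀ {xs ys : List A} → Unique xs → (∀ {x} → x ∈ xs → x ∈ ys) → length xs ≤ length ys
  Unique⇒length≤ {xs} {ys} u xs⊆ys = injective⇒≤ λ {i} {j} e → Unique⇒lookup-injective u i j (begin
    List.lookup xs i                   ≡⟨ lookup-index (xs⊆ys (∈-lookup i)) ⟩
    List.lookup ys (position i)        ≡⟨ cong (List.lookup ys) e ⟩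
    List.lookup ys (position j)        ≡⟨ lookup-index (xs⊆ys (∈-lookup j)) ⟨
    List.lookup xs j                   ∎)
    where
    open ≡-Reasoning
    position : Fin (length xs) → Fin (length ys)
    position i = index (xs⊆ys (∈-lookup i))

  Any-disjoint⇒≤length : ∀ {m} {xs : List A} (P : Fin m → A → Set) → (∀ s → Any (P s) xs) →
    (∀ {s s' x} → P s x → P s' x → s ≡ s') → m ≤ length xs
  Any-disjoint⇒≤length {xs = xs} P witnesses disjoint = injective⇒≤ λ {s} {s'} e →
    disjoint (lookup-index (witnesses s))
             (subst (λ i → P s' (List.lookup xs i)) (sym e) (lookup-index (witnesses s')))

dsub≤length : ∀ {σ n} (M : Mat (Fin σ) n) k (k≤n : k ≤ n) (L : List (Vec (Vec (Fin σ) k) k)) →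
  (∀ i j → window M k k≤n i j ∈ L) → dsub M k k≤n ≤ length L
dsub≤length {σ} {n} M k k≤n L windows∈L =
  Unique⇒length≤ (Unique.deduplicate-! _≟²_ allWindows) λ w∈ →
    let (i , j) , _ , w≡ = ∈-map⁻ (λ (i , j) → window M k k≤n i j) (∈-deduplicate⁻ _≟²_ allWindows w∈)
    in subst (_∈ L) (sym w≡) (windows∈L i j)
  where
  _≟²_ : DecidableEquality (Vec (Vec (Fin σ) k) k)
  _≟²_ = ≡-dec (≡-dec Fin._≟_)
  corners : List (Pos n k)
  corners = allFin (suc (n ∸ k))
  allWindows : List (Vec (Vec (Fin σ) k) k)
  allWindows = map (λ (i , j) → window M k k≤n i j) (cartesianProduct corners corners)

IsSquare : ℕ → Set
IsSquare p = ∃ λ t → t * t ≡ p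

isSquare? : Decidable IsSquare
isSquare? p = map′ (λ (t , _ , t²) → t , t²) (λ (t , t²) → t , root<suc t t² , t²)
  (anyUpTo? (λ t → t * t ≟ p) (suc p))
  where
  root<suc : ∀ t → t * t ≡ p → t < suc p
  root<suc zero _ = z<s
  root<suc t@(suc _) refl = s≤s (m≤m*n t t)

square-suc : ∀ a → suc a * suc a ≡ a * a + (a + a + 1)
square-suc = solve-∀

square-cancel-< : ∀ {a b} → a * a < b * b → a < b
square-cancel-< h = ≰⇒> λ b≤a → <⇒≱ h (*-mono-≤ b≤a b≤a)

square-cancel-≤ : ∀ {a b} → a * a ≤ b * b → a ≤ b
square-cancel-≤ h = ≮⇒≥ λ b<a → <⇒≱ (*-mono-< b<a b<a) h

no-square-between : ∀ {t p} → t * t < p → p < suc t * suc t → ¬ IsSquare p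
no-square-between {t} lo hi (c , refl) = <⇒≱ hi (*-mono-≤ t<c t<c)
  where
  t<c : t < c
  t<c = square-cancel-< lo

square-gap : ∀ {k a b} → k ≤ a → a < b → a * a + k < b * b
square-gap {k} {a} {b} k≤a a<b = begin-strict
  a * a + k            ≤⟨ +-monoʳ-≤ (a * a) k≤a ⟩
  a * a + a            <⟨ +-monoʳ-< (a * a) (≤-<-trans (m≤m+n a a) (m<m+n (a + a) z<s)) ⟩
  a * a + (a + a + 1)  ≡⟨ square-suc a ⟨
  suc a * suc a        ≤⟨ *-mono-≤ a<b a<b ⟩
  b * b                ∎
  where open ≤-Reasoning

square-offsets-apart : ∀ {k p r r' a b} → k * k ≤ p → a * a ≡ p + r → b * b ≡ p + r' →
  a < b → r + k < r'
square-offsets-apart {k} {p} {r} {r'} {a} {b} k²≤p a² b² a<b = +-cancelˡ-< p (r + k) r' (begin-strict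
  p + (r + k)  ≡⟨ +-assoc p r k ⟨
  p + r + k    ≡⟨ cong (_+ k) a² ⟨
  a * a + k    <⟨ square-gap k≤a a<b ⟩
  b * b        ≡⟨ b² ⟩
  p + r'       ∎)
  where
  open ≤-Reasoning
  k≤a : k ≤ a
  k≤a = square-cancel-≤ (≤-trans k²≤p (≤-trans (m≤m+n p r) (≤-reflexive (sym a²))))

square-offset-unique : ∀ {k p r r'} → k * k ≤ p → r < k → r' < k →
  IsSquare (p + r) → IsSquare (p + r') → r ≡ r'
square-offset-unique {k} {p} {r} {r'} k²≤p r<k r'<k (a , a²) (b , b²) with <-cmp a b
... | tri< a<b _ _ = ⊥-elim (<⇒≱ (square-offsets-apart k²≤p a² b² a<b) (≤-trans (<⇒≤ r'<k) (m≤n+m k r)))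
... | tri≈ _ refl _ = +-cancelˡ-≡ p r r' (trans (sym a²) b²)
... | tri> _ _ b<a = ⊥-elim (<⇒≱ (square-offsets-apart k²≤p b² a² b<a) (≤-trans (<⇒≤ r<k) (m≤n+m k r')))

double-injective : ∀ {a b} → a + a ≡ b + b → a ≡ b
double-injective {a} {b} e with <-cmp a b
... | tri< a<b _ _ = ⊥-elim (<-irrefl e (+-mono-< a<b a<b))
... | tri≈ _ a≡b _ = a≡b
... | tri> _ _ b<a = ⊥-elim (<-irrefl (sym e) (+-mono-< b<a b<a))

-- The first square after a² is a² + (2a + 1).
consecutive-squares : ∀ {a i t} → a * a ≡ i → IsSquare (i + (t + t + 1)) →
  (∀ {r} → 0 < r → r < t + t + 1 → ¬ IsSquare (i + r)) → a ≡ t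
consecutive-squares {a} {_} {t} refl (b , b²) none-between =
  double-injective (+-cancelʳ-≡ 1 (a + a) (t + t) (+-cancelˡ-≡ (a * a) _ _ (begin
    a * a + (a + a + 1)  ≡⟨ square-suc a ⟨
    suc a * suc a        ≡⟨ cong (λ x → x * x) b≡suc-a ⟨
    b * b                ≡⟨ b² ⟩
    a * a + (t + t + 1)  ∎)))
  where
  open ≡-Reasoning
  gap>0 : ∀ c → 0 < c + c + 1
  gap>0 c = m≤n+m 1 (c + c)
  a<b : a < b
  a<b = square-cancel-< (subst (a * a <_) (sym b²) (m<m+n (a * a) (gap>0 t)))
  b≡suc-a : b ≡ suc a
  b≡suc-a with suc a <? b
  ... | no b≤suc-a = ≤-antisym (≮⇒≥ b≤suc-a) a<b
  ... | yes suc-a<b = ⊥-elim (none-between (gap>0 a)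
          (+-cancelˡ-< (a * a) _ _ (subst₂ _<_ (square-suc a) b² (*-mono-< suc-a<b suc-a<b)))
          (suc a , square-suc a))

indicator : Bool → Fin 2
indicator true = Fin.suc Fin.zero
indicator false = Fin.zero

columnIndicator : {P : Pred ℕ 0ℓ} → Decidable P → ℕ → ℕ → Fin 2
columnIndicator P? p zero = indicator (does (P? p))
columnIndicator P? p (suc q) = Fin.zero

module _ {P : Pred ℕ 0ℓ} (P? : Decidable P) where

  columnIndicator-yes : ∀ {p} → P p → columnIndicator P? p 0 ≡ Fin.suc Fin.zero
  columnIndicator-yes {p} Pp = cong indicator (dec-true (P? p) Pp)

  columnIndicator-no : ∀ {p} → ¬ P p → columnIndicator P? p 0 ≡ Fin.zero
  columnIndicator-no {p} ¬Pp = cong indicator (dec-false (P? p) ¬Pp)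

  columnIndicator-transfer : ∀ {p p'} → columnIndicator P? p 0 ≡ columnIndicator P? p' 0 → P p → P p'
  columnIndicator-transfer {p} {p'} e Pp with P? p'
  ... | yes Pp' = Pp'
  ... | no _ = ⊥-elim (0≢1+n (trans (sym e) (columnIndicator-yes Pp)))

  columnIndicator-cong : ∀ {Q : Pred ℕ 0ℓ} (Q? : Decidable Q) {p p'} → P p ⇔ Q p' →
    ∀ q → columnIndicator P? p q ≡ columnIndicator Q? p' q
  columnIndicator-cong Q? {p} {p'} P⇔Q zero = cong indicator (does-⇔ P⇔Q (P? p) (Q? p'))
  columnIndicator-cong Q? P⇔Q (suc q) = refl

mark : ℕ → ℕ → Fin 2
mark = columnIndicator isSquare?

squareColumn : (n : ℕ) → Mat (Fin 2) n
squareColumn n a b = mark (toℕ a) (toℕ b)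

Block : ℕ → Set
Block k = Vec (Vec (Fin 2) k) k

block : (k p q : ℕ) → Block k
block k p q = tabulate λ r → tabulate λ s → mark (p + toℕ r) (q + toℕ s)

window-squareColumn : ∀ {n k} (k≤n : k ≤ n) (i j : Pos n k) →
  window (squareColumn n) k k≤n i j ≡ block k (toℕ i) (toℕ j)
window-squareColumn k≤n i j = tabulate-cong λ r → tabulate-cong λ s →
  cong₂ mark (toℕ-fromℕ< (bound k≤n i r)) (toℕ-fromℕ< (bound k≤n j s))

block-entry : ∀ {k} p q p' q' {r s} → block k p q ≡ block k p' q' → r < k → s < k →
  mark (p + r) (q + s) ≡ mark (p' + r) (q' + s)
block-entry {k} p q p' q' {r} {s} e r<k s<k = begin
  mark (p + r) (q + s)                 ≡⟨ entry p q ⟨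
  lookup (lookup (block k p q) R) S    ≡⟨ cong (λ B → lookup (lookup B R) S) e ⟩
  lookup (lookup (block k p' q') R) S  ≡⟨ entry p' q' ⟩
  mark (p' + r) (q' + s)               ∎
  where
  open ≡-Reasoning
  R = fromℕ< r<k
  S = fromℕ< s<k
  entry : ∀ x y → lookup (lookup (block k x y) R) S ≡ mark (x + r) (y + s)
  entry x y = begin
    lookup (lookup (block k x y) R) S  ≡⟨ cong (λ v → lookup v S) (lookup∘tabulate _ R) ⟩
    lookup (tabulate _) S              ≡⟨ lookup∘tabulate _ S ⟩
    mark (x + toℕ R) (y + toℕ S)       ≡⟨ cong₂ (λ r s → mark (x + r) (y + s)) (toℕ-fromℕ< r<k) (toℕ-fromℕ< s<k) ⟩
    mark (x + r) (y + s)               ∎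

zeroBlock : (k : ℕ) → Block k
zeroBlock k = tabulate λ _ → tabulate λ _ → Fin.zero

pointBlock : (k o : ℕ) → Block k
pointBlock k o = tabulate λ r → tabulate λ s → columnIndicator (_≟ o) (toℕ r) (toℕ s)

block-no-square : ∀ {k p} → ¬ (∃ λ o → o < k × IsSquare (p + o)) → block k p 0 ≡ zeroBlock k
block-no-square {k} {p} none = tabulate-cong λ r → tabulate-cong λ s → blank r (toℕ s)
  where
  blank : (r : Fin k) (s : ℕ) → mark (p + toℕ r) s ≡ Fin.zero
  blank r zero = columnIndicator-no isSquare? λ sq → none (toℕ r , toℕ<n r , sq)
  blank r (suc s) = refl

block-one-square : ∀ {k p o} → k * k ≤ p → o < k → IsSquare (p + o) → block k p 0 ≡ pointBlock k o
block-one-square {k} {p} {o} k²≤p o<k sq = tabulate-cong λ r → tabulate-cong λ s →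
  columnIndicator-cong isSquare? (_≟ o)
    (mk⇔ (λ sq' → square-offset-unique k²≤p (toℕ<n r) o<k sq' sq) (λ { refl → sq }))
    (toℕ s)

-- A block meeting column 0 below row k² contains at most one square, so at most one 1.
blockCandidates : (k : ℕ) → List (Block k)
blockCandidates k = zeroBlock k ∷ map (pointBlock k) (upTo k) ++ map (λ p → block k p 0) (upTo (k * k))

block∈blockCandidates : ∀ k p q → block k p q ∈ blockCandidates k
block∈blockCandidates k p (suc q) = here refl
block∈blockCandidates k p zero with p <? k * k
... | yes p<k² = there (∈-++⁺ʳ (map (pointBlock k) (upTo k)) (∈-map⁺ (λ p → block k p 0) (∈-upTo⁺ p<k²)))
... | no p≮k² with anyUpTo? (λ o → isSquare? (p + o)) k
...   | yes (o , o<k , sq) =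
          there (subst (_∈ _) (sym (block-one-square (≮⇒≥ p≮k²) o<k sq)) (∈-++⁺ˡ (∈-map⁺ (pointBlock k) (∈-upTo⁺ o<k))))
...   | no none = here (block-no-square none)

length-blockCandidates : ∀ k → length (blockCandidates k) ≡ suc (k + k * k)
length-blockCandidates k = cong suc (begin
  length (map (pointBlock k) (upTo k) ++ map (λ p → block k p 0) (upTo (k * k)))
    ≡⟨ length-++ (map (pointBlock k) (upTo k)) ⟩
  length (map (pointBlock k) (upTo k)) + length (map (λ p → block k p 0) (upTo (k * k)))
    ≡⟨ cong₂ _+_ (length-map (pointBlock k) (upTo k)) (length-map (λ p → block k p 0) (upTo (k * k))) ⟩
  length (upTo k) + length (upTo (k * k))
    ≡⟨ cong₂ _+_ (length-upTo k) (length-upTo (k * k)) ⟩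
  k + k * k ∎)
  where open ≡-Reasoning

dsub-squareColumn : ∀ {n k} → 1 ≤ k → (k≤n : k ≤ n) → dsub (squareColumn n) k k≤n ≤ 3 * (k * k)
dsub-squareColumn {n} {k@(suc _)} _ k≤n = begin
  dsub (squareColumn n) k k≤n  ≤⟨ dsub≤length (squareColumn n) k k≤n (blockCandidates k) windows∈ ⟩
  length (blockCandidates k)   ≡⟨ length-blockCandidates k ⟩
  1 + (k + k * k)              ≤⟨ +-mono-≤ (s≤s z≤n) (+-mono-≤ (m≤m*n k k) (m≤m+n (k * k) 0)) ⟩
  3 * (k * k)                  ∎
  where
  open ≤-Reasoning
  windows∈ : ∀ i j → window (squareColumn n) k k≤n i j ∈ blockCandidates k
  windows∈ i j = subst (_∈ blockCandidates k) (sym (window-squareColumn k≤n i j)) (block∈blockCandidates k (toℕ i) (toℕ j))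

span : ℕ → ℕ
span t = suc (t + t + 1)

-- The block of height span t at (t², 0) sees t² and (t + 1)² as the only squares in column 0.
gapBlock-rigid : ∀ t i j → block (span t) i j ≡ block (span t) (t * t) 0 → i ≡ t * t
gapBlock-rigid t i (suc j) e =
  ⊥-elim (0≢1+n (trans (block-entry i (suc j) (t * t) 0 e z<s z<s) (columnIndicator-yes isSquare? (t , sym (+-identityʳ (t * t))))))
gapBlock-rigid t i zero e =
  let (a , a²) = subst IsSquare (+-identityʳ i) (square⇒square z<s (t , sym (+-identityʳ (t * t))))
  in trans (sym a²) (cong (λ x → x * x) (consecutive-squares {a} {t = t} a² last none-between))
  where
  square⇒square : ∀ {r} → r < span t → IsSquare (t * t + r) → IsSquare (i + r)
  square⇒square r<span = columnIndicator-transfer isSquare? (sym (block-entry i 0 (t * t) 0 e r<span z<s))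
  last : IsSquare (i + (t + t + 1))
  last = square⇒square ≤-refl (suc t , square-suc t)
  none-between : ∀ {r} → 0 < r → r < t + t + 1 → ¬ IsSquare (i + r)
  none-between {r} 0<r r<gap sq = no-square-between {t}
    (m<m+n (t * t) 0<r)
    (subst (t * t + r <_) (sym (square-suc t)) (+-monoʳ-< (t * t) r<gap))
    (columnIndicator-transfer isSquare? (block-entry i 0 (t * t) 0 e (m<n⇒m<1+n r<gap) z<s) sq)

gapBlock-occurrence-row : ∀ {n} t (span≤n : span t ≤ n) (t²<corners : t * t < suc (n ∸ span t))
  (i' j' : Pos n (span t)) →
  window (squareColumn n) (span t) span≤n i' j' ≡ window (squareColumn n) (span t) span≤n (fromℕ< t²<corners) Fin.zero →
  toℕ i' ≡ t * t
gapBlock-occurrence-row {n} t span≤n t²<corners i' j' same = gapBlock-rigid t (toℕ i') (toℕ j') (begin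
  block (span t) (toℕ i') (toℕ j')                ≡⟨ window-squareColumn span≤n i' j' ⟨
  window (squareColumn n) (span t) span≤n i' j'    ≡⟨ same ⟩
  window (squareColumn n) (span t) span≤n (fromℕ< t²<corners) Fin.zero
    ≡⟨ window-squareColumn span≤n (fromℕ< t²<corners) Fin.zero ⟩
  block (span t) (toℕ (fromℕ< t²<corners)) 0      ≡⟨ cong (λ x → block (span t) x 0) (toℕ-fromℕ< t²<corners) ⟩
  block (span t) (t * t) 0                        ∎)
  where open ≡-Reasoning

InBand : ∀ {n} → ℕ → Fin n × Fin n → Set
InBand t (a , _) = t * t ≤ toℕ a × toℕ a ≤ suc t * suc t

crossing⇒InBand : ∀ {n t} {i' j' : Pos n (span t)} → toℕ i' ≡ t * t →
  ∀ {x} → Crosses {n} {span t} i' j' x → InBand t x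
crossing⇒InBand {t = t} {i'} i'≡t² {a , _} ((i'≤a , a<i'+span) , _) =
  subst (_≤ toℕ a) i'≡t² i'≤a , ≤-pred (subst (toℕ a <_) top-row a<i'+span)
  where
  open ≡-Reasoning
  top-row : toℕ i' + span t ≡ suc (suc t * suc t)
  top-row = begin
    toℕ i' + span t            ≡⟨ cong (_+ span t) i'≡t² ⟩
    t * t + suc (t + t + 1)    ≡⟨ +-suc (t * t) (t + t + 1) ⟩
    suc (t * t + (t + t + 1))  ≡⟨ cong suc (square-suc t) ⟨
    suc (suc t * suc t)        ∎

attractor-meets-band : ∀ {n Γ} → IsAttractor2D (squareColumn n) Γ →
  ∀ t → t * t + span t ≤ n → Any (InBand t) Γ
attractor-meets-band {n} attractor t fits =
  let (i' , j' , same , crosses) = attractor (span t) (s≤s z≤n) span≤n (fromℕ< t²<corners) Fin.zero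
  in Any.map (crossing⇒InBand {t = t} (gapBlock-occurrence-row t span≤n t²<corners i' j' same)) crosses
  where
  span≤n : span t ≤ n
  span≤n = ≤-trans (m≤n+m (span t) (t * t)) fits
  t²<corners : t * t < suc (n ∸ span t)
  t²<corners = s≤s (m+n≤o⇒m≤o∸n (t * t) fits)

double-mono-< : ∀ {s s'} → s < s' → suc (s + s) < s' + s'
double-mono-< {s} {s'} s<s' = subst (_≤ s' + s') (cong suc (+-suc s s)) (+-mono-≤ s<s' s<s')

InBand-even-unique : ∀ {n s s'} {x : Fin n × Fin n} → InBand (s + s) x → InBand (s' + s') x → s ≡ s'
InBand-even-unique {s = s} {s'} (lo , hi) (lo' , hi') with <-cmp s s'
... | tri< s<s' _ _ = ⊥-elim (<⇒≱ (*-mono-< (double-mono-< s<s') (double-mono-< s<s')) (≤-trans lo' hi))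
... | tri≈ _ s≡s' _ = s≡s'
... | tri> _ _ s'<s = ⊥-elim (<⇒≱ (*-mono-< (double-mono-< s'<s) (double-mono-< s'<s)) (≤-trans lo hi'))

attractor-length≥ : ∀ {n m Γ} → IsAttractor2D (squareColumn n) Γ →
  (∀ (s : Fin m) → let t = toℕ s + toℕ s in t * t + span t ≤ n) → m ≤ length Γ
attractor-length≥ attractor fits =
  Any-disjoint⇒≤length (λ s → InBand (toℕ s + toℕ s))
    (λ s → attractor-meets-band attractor (toℕ s + toℕ s) (fits s))
    (λ {s} {s'} {x} b b' → toℕ-injective (InBand-even-unique {s = toℕ s} {toℕ s'} {x} b b'))

square-suc-suc : ∀ t → suc (suc t) * suc (suc t) ≡ t * t + suc (t + t + 1) + suc (t + t + 1)
square-suc-suc = solve-∀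

double-square : ∀ m → (m + m) * (m + m) ≡ 4 * (m * m)
double-square = solve-∀

even-band-fits : ∀ {m} (s : Fin m) → let t = toℕ s + toℕ s in t * t + span t ≤ (m + m) * (m + m)
even-band-fits {m} s = begin
  t * t + span t               ≤⟨ m≤m+n (t * t + span t) (span t) ⟩
  t * t + span t + span t      ≡⟨ square-suc-suc t ⟨
  suc (suc t) * suc (suc t)    ≤⟨ *-mono-≤ t+2≤2m t+2≤2m ⟩
  (m + m) * (m + m)            ∎
  where
  open ≤-Reasoning
  t = toℕ s + toℕ s
  t+2≤2m : suc (suc t) ≤ m + m
  t+2≤2m = double-mono-< (toℕ<n s)

lemma4 : Σ ℕ λ σ → Σ ℕ λ C → Σ ℕ λ a → (N : ℕ) →
    Σ ℕ λ n → N ≤ n × Σ (Mat (Fin σ) n) λ M →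
      ((k : ℕ) → 1 ≤ k → (k≤n : k ≤ n) → dsub M k k≤n ≤ C * (k * k)) ×
      ((Γ : List (Fin n × Fin n)) → Unique Γ → IsAttractor2D M Γ →
         n ≤ a * (length Γ * length Γ))
lemma4 = 2 , 3 , 4 , λ N →
  side N * side N , N≤side² N , squareColumn (side N * side N) ,
  (λ k 1≤k k≤n → dsub-squareColumn 1≤k k≤n) ,
  λ Γ _ attractor → attractor-bound N Γ (attractor-length≥ attractor even-band-fits)
  where
  side : ℕ → ℕ
  side N = suc N + suc N
  N≤side² : ∀ N → N ≤ side N * side N
  N≤side² N = ≤-trans (n≤1+n N) (≤-trans (m≤m+n (suc N) (suc N)) (m≤m*n (side N) (side N)))
  attractor-bound : ∀ N (Γ : List (Fin (side N * side N) × Fin (side N * side N))) →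
    suc N ≤ length Γ → side N * side N ≤ 4 * (length Γ * length Γ)
  attractor-bound N Γ N<|Γ| = subst (_≤ 4 * (length Γ * length Γ)) (sym (double-square (suc N)))
    (*-monoʳ-≤ 4 (*-mono-≤ N<|Γ| N<|Γ|))
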